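{- Let $\mathcal{C}$ be a neural code on $n$ neurons with $|\mathcal{C}|=m>3$. If the codeword containment graph $G_\mathcal{C}$ is connected and $2$-regular, then $m$ is even.
   Context: A neural code on $n$ neurons is a collection of subsets of $[n]$. The codeword containment graph $G_\mathcal{C}$ of $\mathcal{C}$ is the undirected simple graph with vertex set $\mathcal{C}$ in which $\sigma,\tau$ are adjacent iff $\sigma\subsetneq\tau$ or $\tau\subsetneq\sigma$. A graph is $2$-regular if every vertex has degree exactly $2$. -}

module Defs where

open import Data.Nat using (ℕ)
open import Data.Fin using (Fin)
open import Data.Fin.Subset using (Subset; _⊂_)
open import Data.Product using (Σ; ∃; _×_; _,_)
open import Data.Sum using (_⊎_)
open import Relation.Binary.PropositionalEquality using (_≡_; _≢_)
open import Function.Definitions using (Injective)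

-- A neural code on n neurons with m codewords, presented as an
-- injective enumeration of its (distinct) codewords.
record NeuralCode (n m : ℕ) : Set where
  field
    word      : Fin m → Subset n
    word-inj  : Injective _≡_ _≡_ word

open NeuralCode public

Adj : ∀ {n m} → NeuralCode n m → Fin m → Fin m → Set
Adj C i j = (word C i ⊂ word C j) ⊎ (word C j ⊂ word C i)

data Walk {n m} (C : NeuralCode n m) : Fin m → Fin m → Set where
  [] : ∀ {i} → Walk C i i
  _∷_ : ∀ {i j k} → Adj C i j → Walk C j k → Walk C i k

Connected : ∀ {n m} → NeuralCode n m → Set
Connected C = ∀ i j → Walk C i j

Degree2 : ∀ {n m} → NeuralCode n m → Fin m → Set
Degree2 C i =
  Σ _ λ j → Σ _ λ k → j ≢ k × Adj C i j × Adj C i k ×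
    (∀ l → Adj C i l → (l ≡ j) ⊎ (l ≡ k))

TwoRegular : ∀ {n m} → NeuralCode n m → Set
TwoRegular C = ∀ i → Degree2 C i

-- Since m > 3, the graph contains no triangle: in a connected 2-regular graph a
-- triangle is a whole connected component. Hence there is no chain σ ⊊ τ ⊊ ρ of
-- codewords, so every codeword lies either strictly below all its neighbours or
-- strictly above all of them, and no two codewords of the same kind are adjacent.
-- Counting the edges once from their lower ends and once from their upper ends
-- gives 2·#lower = 2·#upper, so m = #lower + #upper = 2·#lower.
module Submission where

open import Defs
open import Algebra.Properties.Semiring.Sum using ()
open import Data.Bool.Base using (Bool; true; false; not)
open import Data.Bool.Properties using (¬-not) renaming (_≟_ to _≟ᵇ_)
open import Data.Empty using (⊥)
open import Data.Fin.Base using (Fin; zero; suc)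
open import Data.Fin.Patterns using (0F; 1F; 2F)
open import Data.Fin.Properties using (_≟_; injective⇒≤)
open import Data.Fin.Subset using (_⊂_)
open import Data.Fin.Subset.Properties using (_⊂?_; ⊂-trans; ⊂-irref; ⊂-asymmetric)
open import Data.Nat.Base using (ℕ; zero; suc; _+_; _*_; _<_; _≤_; NonZero)
open import Data.Nat.Divisibility using (_∣_; divides)
open import Data.Nat.Properties using (+-*-semiring; *-zeroʳ; *-cancelʳ-≡; *-comm; +-identityʳ; <⇒≱)
open import Data.Product.Base using (∃; _,_; proj₁; proj₂)
open import Data.Sum.Base using (_⊎_; inj₁; inj₂; [_,_]; swap)
open import Function.Base using (_∘_)
open import Function.Bundles using (mk⇔)
open import Level using (Level)
open import Relation.Binary.Core using (Rel)
open import Relation.Binary.Definitions using (Decidable; Symmetric)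
open import Relation.Binary.PropositionalEquality
  using (_≡_; _≢_; refl; sym; trans; cong; cong₂; module ≡-Reasoning)
open import Relation.Nullary.Decidable using (Dec; yes; no; does; _⊎-dec_; dec-true; dec-false; does-⇔)
open import Relation.Nullary.Negation using (¬_; contradiction)
open import Relation.Unary using (Pred)

open Algebra.Properties.Semiring.Sum +-*-semiring
  using (sum; sum-cong-≗; ∑-comm; ∑-distrib-+; *-distribʳ-sum; *-distribˡ-sum; sum-replicate-zero)

private
  variable
    ℓ : Level
    m n : ℕ

indicator : Bool → ℕ
indicator true  = 1
indicator false = 0

count : (Fin m → Bool) → ℕ
count p = sum (indicator ∘ p)

point : Fin m → Fin m → Bool
point j l = does (l ≟ j)

count-point : (j : Fin m) → count (point j) ≡ 1
count-point {suc m} zero    = cong suc (sum-replicate-zero m)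
count-point {suc m} (suc j) = count-point j

count-pair : {P : Pred (Fin m) ℓ} (P? : ∀ l → Dec (P l)) {j k : Fin m} →
             j ≢ k → P j → P k → (∀ l → P l → l ≡ j ⊎ l ≡ k) →
             count (does ∘ P?) ≡ 2
count-pair P? {j} {k} j≢k Pj Pk only = begin
  count (does ∘ P?)                                          ≡⟨ sum-cong-≗ split ⟩
  sum (λ l → indicator (point j l) + indicator (point k l))  ≡⟨ ∑-distrib-+ (indicator ∘ point j) (indicator ∘ point k) ⟩
  count (point j) + count (point k)                          ≡⟨ cong₂ _+_ (count-point j) (count-point k) ⟩
  2                                                          ∎
  where
  open ≡-Reasoning
  split : ∀ l → indicator (does (P? l)) ≡ indicator (point j l) + indicator (point k l)
  split l with l ≟ j | l ≟ k
  ... | yes refl | yes refl = contradiction refl j≢k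
  ... | yes refl | no _     = cong indicator (dec-true (P? l) Pj)
  ... | no _     | yes refl = cong indicator (dec-true (P? l) Pk)
  ... | no l≢j   | no l≢k   = cong indicator (dec-false (P? l) ([ l≢j , l≢k ] ∘ only l))

count+count-not : (p : Fin m → Bool) → count p + count (not ∘ p) ≡ m
count+count-not {m} p = begin
  count p + count (not ∘ p)                            ≡⟨ ∑-distrib-+ (indicator ∘ p) (indicator ∘ not ∘ p) ⟨
  sum (λ l → indicator (p l) + indicator (not (p l)))  ≡⟨ sum-cong-≗ (partition ∘ p) ⟩
  sum {m} (λ _ → 1)                                    ≡⟨ sum-ones m ⟩
  m                                                    ∎
  where
  open ≡-Reasoning
  partition : ∀ b → indicator b + indicator (not b) ≡ 1
  partition true  = refl
  partition false = refl
  sum-ones : ∀ m → sum {m} (λ _ → 1) ≡ m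
  sum-ones zero    = refl
  sum-ones (suc m) = cong suc (sum-ones m)

surjection⇒≤ : (g : Fin n → Fin m) → (∀ y → ∃ λ x → g x ≡ y) → m ≤ n
surjection⇒≤ g surj = injective⇒≤ {f = proj₁ ∘ surj} λ {y} {y′} eq →
  trans (sym (proj₂ (surj y))) (trans (cong g eq) (proj₂ (surj y′)))

degree : {E : Rel (Fin m) ℓ} → Decidable E → Fin m → ℕ
degree E? i = count (λ j → does (E? i j))

module _ {E : Rel (Fin m) ℓ} (E? : Decidable E) (E-sym : Symmetric E)
         (colour : Fin m → Bool) (proper : ∀ {i j} → E i j → colour i ≢ colour j) where

  private
    edge : Fin m → Fin m → ℕ
    edge i j = indicator (does (E? i j))

    edge-monochromatic : ∀ {i j} → colour i ≡ colour j → edge i j ≡ 0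
    edge-monochromatic {i} {j} same with E? i j
    ... | yes e = contradiction same (proper e)
    ... | no _  = refl

    -- Each edge is counted once at its `true` end and once at its `false` end.
    edge-transpose : ∀ i j →
                     indicator (colour i) * edge i j ≡ indicator (not (colour j)) * edge j i
    edge-transpose i j with colour i ≟ᵇ colour j
    ... | yes same rewrite edge-monochromatic same | edge-monochromatic (sym same) =
      trans (*-zeroʳ (indicator (colour i))) (sym (*-zeroʳ (indicator (not (colour j)))))
    ... | no differ = cong₂ _*_ (cong indicator (¬-not differ))
                                (cong indicator (does-⇔ (mk⇔ E-sym E-sym) (E? i j) (E? j i)))

  regular⇒colour-classes-equinumerous : ∀ d .{{_ : NonZero d}} → (∀ i → degree E? i ≡ d) →
                                        count colour ≡ count (not ∘ colour)
  regular⇒colour-classes-equinumerous d regular = *-cancelʳ-≡ _ _ d (begin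
    count colour * d                                              ≡⟨ *-distribʳ-sum d (indicator ∘ colour) ⟩
    sum (λ i → indicator (colour i) * d)                          ≡⟨ sum-cong-≗ (weighted-degree colour) ⟨
    sum (λ i → sum (λ j → indicator (colour i) * edge i j))       ≡⟨ ∑-comm (λ i j → indicator (colour i) * edge i j) ⟩
    sum (λ j → sum (λ i → indicator (colour i) * edge i j))       ≡⟨ sum-cong-≗ (λ j → sum-cong-≗ (λ i → edge-transpose i j)) ⟩
    sum (λ j → sum (λ i → indicator (not (colour j)) * edge j i)) ≡⟨ sum-cong-≗ (weighted-degree (not ∘ colour)) ⟩
    sum (λ j → indicator (not (colour j)) * d)                    ≡⟨ *-distribʳ-sum d (indicator ∘ not ∘ colour) ⟨
    count (not ∘ colour) * d                                      ∎)
    where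
    open ≡-Reasoning
    weighted-degree : ∀ (c : Fin m → Bool) i →
                      sum (λ j → indicator (c i) * edge i j) ≡ indicator (c i) * d
    weighted-degree c i =
      trans (sym (*-distribˡ-sum (indicator (c i)) (edge i))) (cong (indicator (c i) *_) (regular i))

module _ (C : NeuralCode n m) where

  Adj-sym : Symmetric (Adj C)
  Adj-sym = swap

  Adj? : Decidable (Adj C)
  Adj? i j = (word C i ⊂? word C j) ⊎-dec (word C j ⊂? word C i)

  ⊂⇒≢ : ∀ {i j} → word C i ⊂ word C j → i ≢ j
  ⊂⇒≢ i⊂j refl = ⊂-irref refl i⊂j

  degree≡2 : ∀ {i} → Degree2 C i → degree Adj? i ≡ 2
  degree≡2 (_ , _ , j≢k , adj-j , adj-k , only) = count-pair (Adj? _) j≢k adj-j adj-k only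

  walk-preserves : {P : Pred (Fin m) ℓ} → (∀ {x y} → P x → Adj C x y → P y) →
                   ∀ {x y} → Walk C x y → P x → P y
  walk-preserves closed []      Px = Px
  walk-preserves closed (a ∷ w) Px = walk-preserves closed w (closed Px a)

  NoThreeChain : Set
  NoThreeChain = ∀ {i j k} → word C i ⊂ word C j → word C j ⊂ word C k → ⊥

  IsLocalMin IsLocalMax : Fin m → Set
  IsLocalMin i = ∀ j → Adj C i j → word C i ⊂ word C j
  IsLocalMax i = ∀ j → Adj C i j → word C j ⊂ word C i

  local-minima-nonadjacent : ∀ {i j} → Adj C i j → IsLocalMin i → ¬ IsLocalMin j
  local-minima-nonadjacent {i} {j} a min-i min-j = ⊂-asymmetric (min-i j a) (min-j i (Adj-sym a))

  local-maxima-nonadjacent : ∀ {i j} → Adj C i j → IsLocalMax i → ¬ IsLocalMax j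
  local-maxima-nonadjacent {i} {j} a max-i max-j = ⊂-asymmetric (max-i j a) (max-j i (Adj-sym a))

  local-extremum : NoThreeChain → ∀ {i j} → Adj C i j → IsLocalMin i ⊎ IsLocalMax i
  local-extremum no-chain (inj₁ i⊂j) = inj₁ λ where
    _ (inj₁ i⊂l) → i⊂l
    _ (inj₂ l⊂i) → contradiction i⊂j (no-chain l⊂i)
  local-extremum no-chain (inj₂ j⊂i) = inj₂ λ where
    _ (inj₁ i⊂l) → contradiction i⊂l (no-chain j⊂i)
    _ (inj₂ l⊂i) → l⊂i

module _ (C : NeuralCode n m) (two-regular : TwoRegular C) where

  neighbours-are : ∀ {i a b l} → Adj C i a → Adj C i b → a ≢ b → Adj C i l → l ≡ a ⊎ l ≡ b
  neighbours-are {i} {a} {b} {l} ia ib a≢b il with two-regular i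
  ... | _ , _ , _ , _ , _ , only with only a ia | only b ib | only l il
  ... | inj₁ refl | inj₁ refl | _  = contradiction refl a≢b
  ... | inj₂ refl | inj₂ refl | _  = contradiction refl a≢b
  ... | inj₁ refl | inj₂ refl | l≡ = l≡
  ... | inj₂ refl | inj₁ refl | l≡ = swap l≡

  triangle⇒≤3 : Connected C → ∀ {i j k} → Adj C i j → Adj C j k → Adj C k i →
                i ≢ j → j ≢ k → k ≢ i → m ≤ 3
  triangle⇒≤3 connected {i} {j} {k} ij jk ki i≢j j≢k k≢i =
    surjection⇒≤ corner λ l → walk-preserves C closed (connected i l) (0F , refl)
    where
    corner : Fin 3 → Fin m
    corner 0F = i
    corner 1F = j
    corner 2F = k

    Corner : Pred (Fin m) _
    Corner l = ∃ λ x → corner x ≡ l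

    either : ∀ x y {l} → l ≡ corner x ⊎ l ≡ corner y → Corner l
    either x y = [ (λ e → x , sym e) , (λ e → y , sym e) ]

    closed : ∀ {l l′} → Corner l → Adj C l l′ → Corner l′
    closed (0F , refl) a = either 1F 2F (neighbours-are ij (Adj-sym C ki) j≢k a)
    closed (1F , refl) a = either 0F 2F (neighbours-are (Adj-sym C ij) jk (k≢i ∘ sym) a)
    closed (2F , refl) a = either 0F 1F (neighbours-are ki (Adj-sym C jk) i≢j a)

  no-three-chain : 3 < m → Connected C → NoThreeChain C
  no-three-chain 3<m connected i⊂j j⊂k = <⇒≱ 3<m
    (triangle⇒≤3 connected (inj₁ i⊂j) (inj₁ j⊂k) (inj₂ i⊂k) (⊂⇒≢ C i⊂j) (⊂⇒≢ C j⊂k) (⊂⇒≢ C i⊂k ∘ sym))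
    where i⊂k = ⊂-trans i⊂j j⊂k

  module _ (no-chain : NoThreeChain C) where

    local-min-or-max : ∀ i → IsLocalMin C i ⊎ IsLocalMax C i
    local-min-or-max i with two-regular i
    ... | _ , _ , _ , a , _ = local-extremum C no-chain a

    local-min? : ∀ i → Dec (IsLocalMin C i)
    local-min? i with two-regular i
    ... | j , _ , _ , a , _ with local-extremum C no-chain a
    ... | inj₁ min = yes min
    ... | inj₂ max = no λ min → ⊂-asymmetric (min j a) (max j a)

    ¬local-min⇒local-max : ∀ {i} → ¬ IsLocalMin C i → IsLocalMax C i
    ¬local-min⇒local-max {i} ¬min =
      [ (λ min → contradiction min ¬min) , (λ max → max) ] (local-min-or-max i)

    is-local-min : Fin m → Bool
    is-local-min i = does (local-min? i)

    is-local-min-proper : ∀ {i j} → Adj C i j → is-local-min i ≢ is-local-min j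
    is-local-min-proper {i} {j} a with local-min? i | local-min? j
    ... | yes min-i  | yes min-j  = λ _ → local-minima-nonadjacent C a min-i min-j
    ... | yes _      | no _       = λ ()
    ... | no _       | yes _      = λ ()
    ... | no ¬min-i  | no ¬min-j  =
      λ _ → local-maxima-nonadjacent C a (¬local-min⇒local-max ¬min-i) (¬local-min⇒local-max ¬min-j)

mainTheorem7 : (n m : ℕ) → (C : NeuralCode n m) → 3 < m →
    Connected C → TwoRegular C → 2 ∣ m
mainTheorem7 n m C 3<m connected two-regular = divides (count lower) (begin
  m                                  ≡⟨ count+count-not lower ⟨
  count lower + count (not ∘ lower)  ≡⟨ cong (count lower +_) equinumerous ⟨
  count lower + count lower          ≡⟨ cong (count lower +_) (+-identityʳ (count lower)) ⟨
  2 * count lower                    ≡⟨ *-comm 2 (count lower) ⟩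
  count lower * 2                    ∎)
  where
  open ≡-Reasoning
  no-chain : NoThreeChain C
  no-chain = no-three-chain C two-regular 3<m connected

  lower : Fin m → Bool
  lower = is-local-min C two-regular no-chain

  equinumerous : count lower ≡ count (not ∘ lower)
  equinumerous = regular⇒colour-classes-equinumerous (Adj? C) (Adj-sym C) lower
    (is-local-min-proper C two-regular no-chain) 2 (λ i → degree≡2 C (two-regular i))
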